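{- Let $L=(e_1,\dots,e_N)$ be a list as below. For $n\ge1$ let $S_n$ be the set of coefficient functions $\epsilon$ that can be written as $\epsilon=\sum_{m=1}^{\ell}\zeta^m$ ($\ell\ge1$), where the $\zeta^m$ are proper $L^*$-blocks at indices $i_1<i_2<\dots<i_\ell$ with pairwise disjoint support intervals and the support interval of $\zeta^\ell$ is $[i,n]$ for some $i\le n$; let $S_0=\{0\}$, and let $C_n=\#S_n$ for $n\ge0$. Then $$C_k=e_1C_{k-1}+e_2C_{k-2}+\cdots+e_kC_0\quad(1\le k\le N),\qquad C_n=\sum_{k=1}^{N-1}e_kC_{n-k}+(1+e_N)C_{n-N}\quad(n\ge N+1).$$
   Context: A coefficient function is a sequence $\mu=(\mu_1,\mu_2,\dots)$ of non-negative integers; $0$ is the zero coefficient function; sums are entrywise. $L=(e_1,\dots,e_N)$ is a list of non-negative integers with $N\ge2$ and $e_1\ne0$. For $n\ge1$, the maximal $L^*$-block at index $n$ is the coefficient function $\bar\beta^n$ with $\bar\beta^n_k=0$ for $k<n$ and $\bar\beta^n_k=e_j$ for $k\ge n$, where $1\le j\le N$ and $k-n+1\equiv j\pmod N$. A proper $L^*$-block at index $n$ is a coefficient function $\zeta$ such that for some $k\ge n$: $\zeta_j=\bar\beta^n_j$ for all $j<k$, $\zeta_k<\bar\beta^n_k$, and $\zeta_j=0$ for $j>k$; its support interval is $[n,k]$ (the zero coefficient function is allowed as a proper block). -}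

module Defs where

open import Data.Nat using (ℕ; zero; suc; _+_; _*_; _∸_; _≤_; _<_; _<?_)
open import Data.Nat.DivMod using (_%_)
open import Data.Fin using (Fin; fromℕ) renaming (_<_ to _<ᶠ_)
open import Data.Vec using (Vec; []; _∷_; tabulate; sum)
open import Data.Product using (Σ; _×_; ∃)
open import Relation.Binary.PropositionalEquality using (_≡_; _≢_)
open import Relation.Nullary using (¬_; yes; no)

-- A coefficient function μ = (μ₁, μ₂, …) is encoded as a function ℕ → ℕ,
-- where μ k is μ_k for k ≥ 1. Position 0 is not part of the paper's
-- object; all coefficient functions that arise below are 0 there.
Coeff : Set
Coeff = ℕ → ℕ

𝟘 : Coeff
𝟘 _ = 0

_≐_ : Coeff → Coeff → Set
μ ≐ ν = ∀ k → μ k ≡ ν k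

nth : ∀ {N} → Vec ℕ N → ℕ → ℕ
nth [] _ = 0
nth (x ∷ xs) zero = x
nth (x ∷ xs) (suc j) = nth xs j

-- e L j = e_j (1-based), for 1 ≤ j ≤ N (value at j = 0 is irrelevant)
e : ∀ {N} → Vec ℕ N → ℕ → ℕ
e L zero = 0
e L (suc j) = nth L j

-- cyc L r = e_j where j ≡ r + 1 (mod N), 1 ≤ j ≤ N
cyc : ∀ {N} → Vec ℕ N → ℕ → ℕ
cyc {zero} L r = 0
cyc {suc m} L r = nth L (r % suc m)

-- the maximal L*-block at index n:  β̄ⁿ_k = 0 for k < n, and
-- β̄ⁿ_k = e_j with k - n + 1 ≡ j (mod N) for k ≥ n
maxBlock : ∀ {N} → Vec ℕ N → ℕ → Coeff
maxBlock L n k with k <? n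
... | yes _ = 0
... | no _ = cyc L (k ∸ n)

ProperBlockSupp : ∀ {N} → Vec ℕ N → ℕ → ℕ → Coeff → Set
ProperBlockSupp L n k ζ =
  n ≤ k ×
  (∀ j → j < k → ζ j ≡ maxBlock L n j) ×
  ζ k < maxBlock L n k ×
  (∀ j → k < j → ζ j ≡ 0)

ProperBlock : ∀ {N} → Vec ℕ N → ℕ → Coeff → Set
ProperBlock L n ζ = Σ ℕ λ k → ProperBlockSupp L n k ζ

DisjointIntervals : ℕ → ℕ → ℕ → ℕ → Set
DisjointIntervals a b c d = ¬ (Σ ℕ λ x → (a ≤ x × x ≤ b) × (c ≤ x × x ≤ d))

InS : ∀ {N} → Vec ℕ N → ℕ → Coeff → Set
InS L zero ε = ε ≐ 𝟘
InS L (suc n') ε =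
  -- ℓ = suc m blocks ζ¹,…,ζ^ℓ at indices idx, with support intervals [idx a, end a]
  Σ ℕ λ m →
  Σ (Fin (suc m) → ℕ) λ idx →
  Σ (Fin (suc m) → ℕ) λ end →
  Σ (Fin (suc m) → Coeff) λ ζ →
    (∀ a → 1 ≤ idx a) ×
    (∀ a → ProperBlockSupp L (idx a) (end a) (ζ a)) ×
    (∀ a b → a <ᶠ b → idx a < idx b) ×
    (∀ a b → a ≢ b → DisjointIntervals (idx a) (end a) (idx b) (end b)) ×
    end (fromℕ m) ≡ suc n' ×
    (∀ x → ε x ≡ sum (tabulate (λ a → ζ a x)))

HasCard : (Coeff → Set) → ℕ → Set
HasCard P c =
  Σ (Fin c → Coeff) λ f →
    (∀ i → P (f i)) ×
    (∀ i j → f i ≐ f j → i ≡ j) ×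
    (∀ ε → P ε → Σ (Fin c) λ i → f i ≐ ε)

∑ : ℕ → (ℕ → ℕ) → ℕ
∑ zero f = 0
∑ (suc k) f = ∑ k f + f (suc k)

{-# OPTIONS --safe #-}
-- Splitting off the block at the smallest index a writes every ε in S_{l+1} uniquely as
-- block a j v + η, where the block has support [a, a + j] and last entry v < e_{(j mod N)+1}, and
-- η lies in a translate of S_{l-j}; a missing block at a is the zero block with j = v = 0.
-- Hence C_{l+1} = Σ_{j ≤ l} e_{(j mod N)+1} C_{l-j}: C is the renewal sequence of the periodic
-- extension of L. For k ≤ N this is the first identity; beyond N, periodicity folds the tail of
-- the sum into C_{n-N}.
module Submission where

open import Defs
open import Data.Nat using (ℕ; zero; suc; pred; _+_; _*_; _∸_; _≤_; _<_; z≤n; s≤s; _<?_)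
open import Data.Nat.Properties
open import Data.Nat.DivMod using (_%_; m<n⇒m%n≡m; [m+n]%n≡m%n)
open import Data.Nat.Induction using (<-rec)
open import Data.Fin using (Fin; zero; suc; fromℕ; splitAt; _↑ˡ_; _↑ʳ_; join) renaming (_<_ to _<ᶠ_)
open import Data.Fin.Properties using (splitAt-↑ˡ; splitAt-↑ʳ; join-splitAt)
  renaming (suc-injective to Fin-suc-injective)
open import Data.Vec using (Vec; []; tabulate; sum)
open import Data.Vec.Functional using (_∷_)
open import Data.Product using (Σ; ∃; _×_; _,_; proj₁)
open import Data.Sum using (_⊎_; inj₁; inj₂)
open import Data.Empty using (⊥-elim)
open import Function using (_∘_)
open import Relation.Binary.PropositionalEquality
open import Relation.Binary.Definitions using (tri<; tri≈; tri>)
open import Relation.Nullary using (¬_; yes; no)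

≐-sym : ∀ {μ ν} → μ ≐ ν → ν ≐ μ
≐-sym p x = sym (p x)

HasCard-resp : ∀ {P Q : Coeff → Set} {c} →
  (∀ {ε} → P ε → Q ε) → (∀ {ε} → Q ε → P ε) → HasCard P c → HasCard Q c
HasCard-resp to from (f , mem , inj , sur) = f , to ∘ mem , inj , λ ε q → sur ε (from q)

HasCard-∅ : ∀ {P : Coeff → Set} → (∀ {ε} → ¬ P ε) → HasCard P 0
HasCard-∅ ¬P = (λ ()) , (λ ()) , (λ ()) , λ ε p → ⊥-elim (¬P p)

HasCard-𝟘 : HasCard (_≐ 𝟘) 1
HasCard-𝟘 = (λ _ → 𝟘) , (λ _ _ → refl) , (λ { zero zero _ → refl }) , λ ε p → zero , ≐-sym p

HasCard-image : ∀ {P : Coeff → Set} {c} (g : Coeff → Coeff) →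
  (∀ {η η′} → η ≐ η′ → g η ≐ g η′) → (∀ {η η′} → g η ≐ g η′ → η ≐ η′) →
  HasCard P c → HasCard (λ ε → Σ Coeff λ η → P η × ε ≐ g η) c
HasCard-image g g-cong g-inj (f , mem , inj , sur) =
  g ∘ f , (λ i → f i , mem i , λ _ → refl) , (λ i j eq → inj i j (g-inj eq)) ,
  λ { ε (η , pη , ε≐) → let (i , fi≐η) = sur η pη in
      i , λ x → trans (g-cong fi≐η x) (sym (ε≐ x)) }

HasCard-⊎ : ∀ {P Q : Coeff → Set} {a b} → HasCard P a → HasCard Q b →
  (∀ {ε ε′} → P ε → Q ε′ → ¬ ε ≐ ε′) → HasCard (λ ε → P ε ⊎ Q ε) (a + b)
HasCard-⊎ {P} {Q} {a} {b} (f , mem , inj , sur) (g , memg , injg , surg) disj =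
  h ∘ splitAt a , mem⊎ ∘ splitAt a , inj-splitAt , sur⊎
  where
  h : Fin a ⊎ Fin b → Coeff
  h (inj₁ i) = f i
  h (inj₂ j) = g j
  mem⊎ : ∀ s → P (h s) ⊎ Q (h s)
  mem⊎ (inj₁ i) = inj₁ (mem i)
  mem⊎ (inj₂ j) = inj₂ (memg j)
  inj⊎ : ∀ s t → h s ≐ h t → s ≡ t
  inj⊎ (inj₁ i) (inj₁ j) eq = cong inj₁ (inj i j eq)
  inj⊎ (inj₁ i) (inj₂ j) eq = ⊥-elim (disj (mem i) (memg j) eq)
  inj⊎ (inj₂ i) (inj₁ j) eq = ⊥-elim (disj (mem j) (memg i) (≐-sym eq))
  inj⊎ (inj₂ i) (inj₂ j) eq = cong inj₂ (injg i j eq)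
  inj-splitAt : ∀ i j → h (splitAt a i) ≐ h (splitAt a j) → i ≡ j
  inj-splitAt i j eq = begin
    i                        ≡⟨ join-splitAt a b i ⟨
    join a b (splitAt a i)   ≡⟨ cong (join a b) (inj⊎ (splitAt a i) (splitAt a j) eq) ⟩
    join a b (splitAt a j)   ≡⟨ join-splitAt a b j ⟩
    j                        ∎
    where open ≡-Reasoning
  sur⊎ : ∀ ε → P ε ⊎ Q ε → Σ (Fin (a + b)) λ i → h (splitAt a i) ≐ ε
  sur⊎ ε (inj₁ p) = let (i , fi≐ε) = sur ε p in
    i ↑ˡ b , subst (λ s → h s ≐ ε) (sym (splitAt-↑ˡ a i b)) fi≐ε
  sur⊎ ε (inj₂ q) = let (j , gj≐ε) = surg ε q in
    a ↑ʳ j , subst (λ s → h s ≐ ε) (sym (splitAt-↑ʳ a b j)) gj≐ε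

HasCard-⋃ : ∀ {Q : ℕ → Coeff → Set} {c : ℕ → ℕ} n →
  (∀ {i} → i < n → HasCard (Q i) (c i)) →
  (∀ {i i′ ε ε′} → i < i′ → Q i ε → Q i′ ε′ → ¬ ε ≐ ε′) →
  HasCard (λ ε → ∃ λ i → i < n × Q i ε) (∑ n (c ∘ pred))
HasCard-⋃ zero _ _ = HasCard-∅ λ { (_ , () , _) }
HasCard-⋃ {Q} (suc n) card disj =
  HasCard-resp to from
    (HasCard-⊎ (HasCard-⋃ n (card ∘ m<n⇒m<1+n) disj) (card ≤-refl)
      λ { (i , i<n , q) q′ → disj i<n q q′ })
  where
  to : ∀ {ε} → (∃ λ i → i < n × Q i ε) ⊎ Q n ε → ∃ λ i → i < suc n × Q i ε
  to (inj₁ (i , i<n , q)) = i , m<n⇒m<1+n i<n , q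
  to (inj₂ q) = n , ≤-refl , q
  from : ∀ {ε} → (∃ λ i → i < suc n × Q i ε) → (∃ λ i → i < n × Q i ε) ⊎ Q n ε
  from (i , i<1+n , q) with m≤n⇒m<n∨m≡n (≤-pred i<1+n)
  ... | inj₁ i<n = inj₁ (i , i<n , q)
  ... | inj₂ refl = inj₂ q

∑-cong : ∀ n {f g : ℕ → ℕ} → (∀ {ℓ} → 1 ≤ ℓ → ℓ ≤ n → f ℓ ≡ g ℓ) → ∑ n f ≡ ∑ n g
∑-cong zero _ = refl
∑-cong (suc n) f≡g =
  cong₂ _+_ (∑-cong n λ 1≤ℓ ℓ≤n → f≡g 1≤ℓ (m≤n⇒m≤1+n ℓ≤n)) (f≡g (s≤s z≤n) ≤-refl)

∑-+ : ∀ a b f → ∑ (a + b) f ≡ ∑ a f + ∑ b (λ ℓ → f (a + ℓ))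
∑-+ a zero f = sym (trans (+-identityʳ (∑ a f)) (cong (λ k → ∑ k f) (sym (+-identityʳ a))))
∑-+ a (suc b) f rewrite +-suc a b | ∑-+ a b f = +-assoc (∑ a f) _ _

∑-const : ∀ n d → ∑ n (λ _ → d) ≡ n * d
∑-const zero d = refl
∑-const (suc n) d = trans (cong (_+ d) (∑-const n d)) (+-comm (n * d) d)

-- renewalHistory w l j = renewal w (l ∸ j): carrying the whole history keeps the recursion structural.
renewalHistory : (ℕ → ℕ) → ℕ → ℕ → ℕ
renewalHistory w zero _ = 1
renewalHistory w (suc l) zero = ∑ (suc l) λ ℓ → w ℓ * renewalHistory w l (pred ℓ)
renewalHistory w (suc l) (suc j) = renewalHistory w l j

renewal : (ℕ → ℕ) → ℕ → ℕ
renewal w n = renewalHistory w n 0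

renewalHistory≡renewal : ∀ w {l j} → j ≤ l → renewalHistory w l j ≡ renewal w (l ∸ j)
renewalHistory≡renewal w {j = zero} _ = refl
renewalHistory≡renewal w {suc l} {suc j} (s≤s j≤l) = renewalHistory≡renewal w j≤l

renewal-suc : ∀ w l → renewal w (suc l) ≡ ∑ (suc l) λ ℓ → w ℓ * renewal w (suc l ∸ ℓ)
renewal-suc w l = ∑-cong (suc l) λ { {suc ℓ} _ ℓ<1+l →
  cong (w (suc ℓ) *_) (renewalHistory≡renewal w (≤-pred ℓ<1+l)) }

renewal-periodic : ∀ w N → (∀ ℓ → w (N + suc ℓ) ≡ w (suc ℓ)) → ∀ {n} → suc N ≤ n →
  renewal w n ≡ ∑ N (λ ℓ → w ℓ * renewal w (n ∸ ℓ)) + renewal w (n ∸ N)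
renewal-periodic w N periodic N<n with m≤n⇒∃[o]m+o≡n N<n
... | r , refl = begin
  renewal w (suc (N + r))                        ≡⟨ renewal-suc w (N + r) ⟩
  ∑ (suc (N + r)) f                              ≡⟨ cong (λ k → ∑ k f) (+-suc N r) ⟨
  ∑ (N + suc r) f                                ≡⟨ ∑-+ N (suc r) f ⟩
  ∑ N f + ∑ (suc r) (λ ℓ → f (N + ℓ))            ≡⟨ cong (∑ N f +_) tail ⟩
  ∑ N f + renewal w (suc r)                      ≡⟨ cong (λ k → ∑ N f + renewal w k) N+1+r∸N ⟨
  ∑ N f + renewal w (suc (N + r) ∸ N)            ∎
  where
  open ≡-Reasoning
  f : ℕ → ℕ
  f ℓ = w ℓ * renewal w (suc (N + r) ∸ ℓ)
  shift : ∀ ℓ → suc (N + r) ∸ (N + ℓ) ≡ suc r ∸ ℓ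
  shift ℓ = trans (cong (_∸ (N + ℓ)) (sym (+-suc N r))) ([m+n]∸[m+o]≡n∸o N (suc r) ℓ)
  N+1+r∸N : suc (N + r) ∸ N ≡ suc r
  N+1+r∸N = trans (cong (suc (N + r) ∸_) (sym (+-identityʳ N))) (shift 0)
  tail : ∑ (suc r) (λ ℓ → f (N + ℓ)) ≡ renewal w (suc r)
  tail = trans
    (∑-cong (suc r) λ { {suc ℓ} _ _ → cong₂ _*_ (periodic ℓ) (cong (renewal w) (shift (suc ℓ))) })
    (sym (renewal-suc w r))

weight : ∀ {N} → Vec ℕ N → ℕ → ℕ
weight L ℓ = cyc L (pred ℓ)

weight≡e : ∀ {N} (L : Vec ℕ N) {ℓ} → 1 ≤ ℓ → ℓ ≤ N → weight L ℓ ≡ e L ℓ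
weight≡e {suc m} L {suc ℓ} _ ℓ<N = cong (nth L) (m<n⇒m%n≡m ℓ<N)

weight-periodic : ∀ {m} (L : Vec ℕ (suc m)) ℓ → weight L (suc m + suc ℓ) ≡ weight L (suc ℓ)
weight-periodic {m} L ℓ = cong (nth L) (trans (cong (_% suc m) m+1+ℓ≡ℓ+1+m) ([m+n]%n≡m%n ℓ (suc m)))
  where
  m+1+ℓ≡ℓ+1+m : m + suc ℓ ≡ ℓ + suc m
  m+1+ℓ≡ℓ+1+m = trans (+-comm m (suc ℓ)) (sym (+-suc ℓ m))

cyc₀>0 : ∀ {N} (L : Vec ℕ N) → e L 1 ≢ 0 → 0 < cyc L 0
cyc₀>0 [] e₁≢0 = ⊥-elim (e₁≢0 refl)
cyc₀>0 {suc m} L e₁≢0 = n≢0⇒n>0 e₁≢0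

module Blocks {N} (L : Vec ℕ N) (e₁≢0 : e L 1 ≢ 0) where

  maxBlock-< : ∀ {a x} → x < a → maxBlock L a x ≡ 0
  maxBlock-< {a} {x} x<a with x <? a
  ... | yes _ = refl
  ... | no x≮a = ⊥-elim (x≮a x<a)

  maxBlock-+ : ∀ a j → maxBlock L a (a + j) ≡ cyc L j
  maxBlock-+ a j with a + j <? a
  ... | yes a+j<a = ⊥-elim (<⇒≱ a+j<a (m≤m+n a j))
  ... | no _ = cong (cyc L) (m+n∸m≡n a j)

  block : ℕ → ℕ → ℕ → Coeff
  block a j v x with <-cmp x (a + j)
  ... | tri< _ _ _ = maxBlock L a x
  ... | tri≈ _ _ _ = v
  ... | tri> _ _ _ = 0

  block-< : ∀ {a j v x} → x < a + j → block a j v x ≡ maxBlock L a x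
  block-< {a} {j} {v} {x} x<a+j with <-cmp x (a + j)
  ... | tri< _ _ _ = refl
  ... | tri≈ x≮ _ _ = ⊥-elim (x≮ x<a+j)
  ... | tri> x≮ _ _ = ⊥-elim (x≮ x<a+j)

  block-end : ∀ a j v → block a j v (a + j) ≡ v
  block-end a j v with <-cmp (a + j) (a + j)
  ... | tri< _ ≢ _ = ⊥-elim (≢ refl)
  ... | tri≈ _ _ _ = refl
  ... | tri> _ ≢ _ = ⊥-elim (≢ refl)

  block-> : ∀ {a j v x} → a + j < x → block a j v x ≡ 0
  block-> {a} {j} {v} {x} a+j<x with <-cmp x (a + j)
  ... | tri< _ _ ≯ = ⊥-elim (≯ a+j<x)
  ... | tri≈ _ _ ≯ = ⊥-elim (≯ a+j<x)
  ... | tri> _ _ _ = refl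

  block-proper : ∀ {a j v} → v < cyc L j → ProperBlockSupp L a (a + j) (block a j v)
  block-proper {a} {j} {v} v<cyc =
    m≤m+n a j , (λ _ → block-<) ,
    subst₂ _<_ (sym (block-end a j v)) (sym (maxBlock-+ a j)) v<cyc , (λ _ → block->)

  block≐𝟘 : ∀ a → block a 0 0 ≐ 𝟘
  block≐𝟘 a x with <-cmp x (a + 0)
  ... | tri< x<a+0 _ _ = maxBlock-< (subst (x <_) (+-identityʳ a) x<a+0)
  ... | tri≈ _ _ _ = refl
  ... | tri> _ _ _ = refl

  proper-block-below : ∀ {a k ζ x} → ProperBlockSupp L a k ζ → x < a → ζ x ≡ 0
  proper-block-below {x = x} (a≤k , below , _ , _) x<a = trans (below x (<-≤-trans x<a a≤k)) (maxBlock-< x<a)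

  proper-block-last< : ∀ {a j ζ} → ProperBlockSupp L a (a + j) ζ → ζ (a + j) < cyc L j
  proper-block-last< {a} {j} (_ , _ , last< , _) = subst (_ <_) (maxBlock-+ a j) last<

  proper-block≐block : ∀ {a j ζ} → ProperBlockSupp L a (a + j) ζ → ζ ≐ block a j (ζ (a + j))
  proper-block≐block {a} {j} {ζ} (_ , below , _ , above) x with <-cmp x (a + j)
  ... | tri< x<a+j _ _ = below x x<a+j
  ... | tri≈ _ refl _ = refl
  ... | tri> _ _ a+j<x = above x a+j<x

  BlockList : ℕ → ℕ → ℕ → Coeff → Set
  BlockList m b n ε =
    Σ (Fin (suc m) → ℕ) λ idx → Σ (Fin (suc m) → ℕ) λ end → Σ (Fin (suc m) → Coeff) λ ζ →
      (∀ a → b ≤ idx a) × (∀ a → ProperBlockSupp L (idx a) (end a) (ζ a)) ×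
      (∀ a c → a <ᶠ c → idx a < idx c) ×
      (∀ a c → a ≢ c → DisjointIntervals (idx a) (end a) (idx c) (end c)) ×
      end (fromℕ m) ≡ n × (∀ x → ε x ≡ sum (tabulate (λ a → ζ a x)))

  BlocksFrom : ℕ → ℕ → Coeff → Set
  BlocksFrom b n ε = Σ ℕ λ m → BlockList m b n ε

  data Chain : ℕ → ℕ → Coeff → Set where
    last : ∀ {b a n ζ ε} → b ≤ a → ProperBlockSupp L a n ζ → ε ≐ ζ → Chain b n ε
    cons : ∀ {b a k n ζ η ε} → b ≤ a → ProperBlockSupp L a k ζ → Chain (suc k) n η →
      ε ≐ (λ x → ζ x + η x) → Chain b n ε

  chain-≤ : ∀ {b n ε} → Chain b n ε → b ≤ n
  chain-≤ (last b≤a (a≤n , _) _) = ≤-trans b≤a a≤n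
  chain-≤ (cons b≤a (a≤k , _) rest _) = ≤-trans b≤a (≤-trans a≤k (<⇒≤ (chain-≤ rest)))

  chain-below : ∀ {b n ε x} → Chain b n ε → x < b → ε x ≡ 0
  chain-below {x = x} (last b≤a pb ε≐) x<b = trans (ε≐ x) (proper-block-below pb (<-≤-trans x<b b≤a))
  chain-below {x = x} (cons b≤a pb rest ε≐) x<b =
    trans (ε≐ x) (cong₂ _+_ (proper-block-below pb x<a)
                            (chain-below rest (m<n⇒m<1+n (<-≤-trans x<a (proj₁ pb)))))
    where
    x<a : x < _
    x<a = <-≤-trans x<b b≤a

  chain→blocks : ∀ {b n ε} → Chain b n ε → BlocksFrom b n ε
  chain→blocks {n = n} (last {a = a} {ζ = ζ} b≤a pb ε≐) =
    0 , (λ _ → a) , (λ _ → n) , (λ _ → ζ) , (λ _ → b≤a) , (λ _ → pb) ,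
    (λ { zero zero () }) , (λ { zero zero a≢a _ → a≢a refl }) , refl ,
    λ x → trans (ε≐ x) (sym (+-identityʳ _))
  chain→blocks {b} (cons {a = a} {k} {ζ = ζ} b≤a pb rest ε≐)
    with chain→blocks rest
  ... | m , idx , end , ζs , lb , pbs , ord , disj , end≡n , sum≡ =
    suc m , a ∷ idx , k ∷ end , ζ ∷ ζs , lb′ , pbs′ , ord′ , disj′ , end≡n ,
    λ x → trans (ε≐ x) (cong (ζ x +_) (sum≡ x))
    where
    a<idx : ∀ c → a < idx c
    a<idx c = ≤-<-trans (proj₁ pb) (lb c)
    lb′ : ∀ c → b ≤ (a ∷ idx) c
    lb′ zero = b≤a
    lb′ (suc c) = ≤-trans b≤a (<⇒≤ (a<idx c))
    pbs′ : ∀ c → ProperBlockSupp L ((a ∷ idx) c) ((k ∷ end) c) ((ζ ∷ ζs) c)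
    pbs′ zero = pb
    pbs′ (suc c) = pbs c
    ord′ : ∀ c d → c <ᶠ d → (a ∷ idx) c < (a ∷ idx) d
    ord′ zero (suc d) _ = a<idx d
    ord′ (suc c) (suc d) (s≤s c<d) = ord c d c<d
    disj′ : ∀ c d → c ≢ d →
      DisjointIntervals ((a ∷ idx) c) ((k ∷ end) c) ((a ∷ idx) d) ((k ∷ end) d)
    disj′ zero zero c≢c _ = c≢c refl
    disj′ zero (suc d) _ (x , (_ , x≤k) , (idx≤x , _)) = <-irrefl refl (≤-trans (lb d) (≤-trans idx≤x x≤k))
    disj′ (suc c) zero _ (x , (idx≤x , _) , (_ , x≤k)) = <-irrefl refl (≤-trans (lb c) (≤-trans idx≤x x≤k))
    disj′ (suc c) (suc d) c≢d = disj c d (c≢d ∘ cong suc)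

  blockList→chain : ∀ m {b n ε} → BlockList m b n ε → Chain b n ε
  blockList→chain zero (idx , end , ζ , lb , pbs , _ , _ , refl , sum≡) =
    last (lb zero) (pbs zero) λ x → trans (sum≡ x) (+-identityʳ _)
  blockList→chain (suc m) {n = n} (idx , end , ζ , lb , pbs , ord , disj , end≡n , sum≡) =
    cons (lb zero) (pbs zero) (blockList→chain m rest) sum≡
    where
    after-first : ∀ i → suc (end zero) ≤ idx (suc i)
    after-first i = ≰⇒> λ idx≤end → disj zero (suc i) (λ ())
      (idx (suc i) , (<⇒≤ (ord zero (suc i) (s≤s z≤n)) , idx≤end) , (≤-refl , proj₁ (pbs (suc i))))
    rest : BlockList m (suc (end zero)) n (λ x → sum (tabulate (λ i → ζ (suc i) x)))
    rest = idx ∘ suc , end ∘ suc , ζ ∘ suc , after-first , pbs ∘ suc ,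
      (λ i c i<c → ord (suc i) (suc c) (s≤s i<c)) ,
      (λ i c i≢c → disj (suc i) (suc c) (i≢c ∘ Fin-suc-injective)) , end≡n , λ _ → refl

  -- S_r with blocks starting at index b or later; InS L r is the case b = 1.
  S-from : ℕ → ℕ → Coeff → Set
  S-from b zero ε = ε ≐ 𝟘
  S-from b (suc l) ε = Chain b (b + l) ε

  S-from-below : ∀ {b r η x} → S-from b r η → x < b → η x ≡ 0
  S-from-below {r = zero} {x = x} η≐𝟘 _ = η≐𝟘 x
  S-from-below {r = suc l} c x<b = chain-below c x<b

  chain→S-from : ∀ {a l j η} → Chain (a + suc j) (a + l) η → S-from (a + suc j) (l ∸ j) η
  chain→S-from {a} {l} {j} {η} c with m≤n⇒∃[o]m+o≡n (+-cancelˡ-≤ a (suc j) l (chain-≤ c))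
  ... | r , refl = subst (λ k → S-from (a + suc j) k η) (sym 1+j+r∸j)
                     (subst (λ n → Chain (a + suc j) n η) (sym (+-assoc a (suc j) r)) c)
    where
    1+j+r∸j : suc j + r ∸ j ≡ suc r
    1+j+r∸j = trans (+-∸-assoc 1 (m≤m+n j r)) (cong suc (m+n∸m≡n j r))

  Split : ℕ → ℕ → ℕ → ℕ → Coeff → Set
  Split a l j v ε = Σ Coeff λ η → S-from (a + suc j) (l ∸ j) η × ε ≐ (λ x → block a j v x + η x)

  Splittable : ℕ → ℕ → Coeff → Set
  Splittable a l ε = ∃ λ j → j < suc l × ∃ λ v → v < cyc L j × Split a l j v ε

  split-value : ∀ {a l j v ε} → Split a l j v ε → ε (a + j) ≡ v
  split-value {a} {l} {j} {v} (η , η∈ , ε≐) = begin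
    _                                  ≡⟨ ε≐ (a + j) ⟩
    block a j v (a + j) + η (a + j)    ≡⟨ cong₂ _+_ (block-end a j v) (S-from-below η∈ (+-monoʳ-< a ≤-refl)) ⟩
    v + 0                              ≡⟨ +-identityʳ v ⟩
    v                                  ∎
    where open ≡-Reasoning

  split-full : ∀ {a l j j′ v′ ε} → j < j′ → Split a l j′ v′ ε → ε (a + j) ≡ cyc L j
  split-full {a} {l} {j} {j′} {v′} j<j′ (η , η∈ , ε≐) = begin
    _                                    ≡⟨ ε≐ (a + j) ⟩
    block a j′ v′ (a + j) + η (a + j)    ≡⟨ cong₂ _+_ (block-< (+-monoʳ-< a j<j′))
                                                     (S-from-below η∈ (+-monoʳ-< a (m<n⇒m<1+n j<j′))) ⟩
    maxBlock L a (a + j) + 0             ≡⟨ +-identityʳ _ ⟩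
    maxBlock L a (a + j)                 ≡⟨ maxBlock-+ a j ⟩
    cyc L j                              ∎
    where open ≡-Reasoning

  split-disjoint-value : ∀ {a l j v v′ ε ε′} → v < v′ → Split a l j v ε → Split a l j v′ ε′ → ¬ ε ≐ ε′
  split-disjoint-value v<v′ s s′ ε≐ε′ =
    <-irrefl (trans (sym (split-value s)) (trans (ε≐ε′ _) (split-value s′))) v<v′

  split-disjoint-length : ∀ {a l j j′ v v′ ε ε′} → j < j′ → v < cyc L j →
    Split a l j v ε → Split a l j′ v′ ε′ → ¬ ε ≐ ε′
  split-disjoint-length j<j′ v<cyc s s′ ε≐ε′ =
    <-irrefl (trans (sym (split-value s)) (trans (ε≐ε′ _) (split-full j<j′ s′))) v<cyc

  split-sound : ∀ {a l ε} → Splittable a l ε → Chain a (a + l) ε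
  split-sound {a} {l} (j , j<1+l , v , v<cyc , η , η∈ , ε≐) with l ∸ j in l∸j
  ... | zero = last ≤-refl (subst (λ k → ProperBlockSupp L a (a + k) (block a j v)) j≡l (block-proper v<cyc))
                 λ x → trans (ε≐ x) (trans (cong (block a j v x +_) (η∈ x)) (+-identityʳ _))
    where
    j≡l : j ≡ l
    j≡l = ≤-antisym (≤-pred j<1+l) (m∸n≡0⇒m≤n l∸j)
  ... | suc r =
    cons ≤-refl (block-proper v<cyc) (subst₂ (λ b n → Chain b n η) (+-suc a j) a+1+j+r≡a+l η∈) ε≐
    where
    a+1+j+r≡a+l : a + suc j + r ≡ a + l
    a+1+j+r≡a+l = begin
      a + suc j + r      ≡⟨ +-assoc a (suc j) r ⟩
      a + (suc j + r)    ≡⟨ cong (a +_) (+-suc j r) ⟨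
      a + (j + suc r)    ≡⟨ cong (λ k → a + (j + k)) l∸j ⟨
      a + (j + (l ∸ j))  ≡⟨ cong (a +_) (m+[n∸m]≡n (≤-pred j<1+l)) ⟩
      a + l              ∎
      where open ≡-Reasoning

  -- With no block starting at a, the split starts with the zero block at a, which is proper as 0 < e₁.
  split-gap : ∀ {a l ε} → Chain (suc a) (a + l) ε → Splittable a l ε
  split-gap {a} {l} {ε} c =
    0 , s≤s z≤n , 0 , cyc₀>0 L e₁≢0 , ε ,
    chain→S-from (subst (λ b → Chain b (a + l) ε) (+-comm 1 a) c) ,
    λ x → sym (cong (_+ ε x) (block≐𝟘 a x))

  split-complete : ∀ {a l ε} → Chain a (a + l) ε → Splittable a l ε
  split-complete (last a≤a′ pb ε≐) with m≤n⇒m<n∨m≡n a≤a′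
  ... | inj₁ a<a′ = split-gap (last a<a′ pb ε≐)
  split-complete {a} {l} (last {ζ = ζ} _ pb ε≐) | inj₂ refl =
    l , ≤-refl , ζ (a + l) , proper-block-last< pb , 𝟘 ,
    subst (λ r → S-from (a + suc l) r 𝟘) (sym (n∸n≡0 l)) (λ _ → refl) ,
    λ x → trans (ε≐ x) (trans (proper-block≐block pb x) (sym (+-identityʳ _)))
  split-complete (cons a≤a′ pb rest ε≐) with m≤n⇒m<n∨m≡n a≤a′
  ... | inj₁ a<a′ = split-gap (cons a<a′ pb rest ε≐)
  split-complete {a} {l} (cons {ζ = ζ} {η} _ pb rest ε≐) | inj₂ refl with m≤n⇒∃[o]m+o≡n (proj₁ pb)
  ... | j , refl =
    j , m<n⇒m<1+n (+-cancelˡ-< a j l (chain-≤ rest)) , ζ (a + j) , proper-block-last< pb , η ,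
    chain→S-from (subst (λ b → Chain b (a + l) η) (sym (+-suc a j)) rest) ,
    λ x → trans (ε≐ x) (cong (_+ η x) (proper-block≐block pb x))

  S-from-card : ∀ r b → HasCard (S-from b r) (renewal (weight L) r)
  S-from-card = <-rec _ step
    where
    D : ℕ → ℕ
    D = renewal (weight L)
    step : ∀ r → (∀ {r′} → r′ < r → ∀ b → HasCard (S-from b r′) (D r′)) →
      ∀ b → HasCard (S-from b r) (D r)
    step zero _ _ = HasCard-𝟘
    step (suc l) IH a =
      HasCard-resp split-sound split-complete
        (subst (HasCard (Splittable a l)) count
          (HasCard-⋃ {c = λ j → cyc L j * D (l ∸ j)} (suc l) by-length
            λ { j<j′ (_ , v<cyc , s) (_ , _ , s′) → split-disjoint-length j<j′ v<cyc s s′ }))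
      where
      by-value : ∀ {j v} → HasCard (Split a l j v) (D (l ∸ j))
      by-value {j} {v} =
        HasCard-image (λ η x → block a j v x + η x) (λ η≐ x → cong (block a j v x +_) (η≐ x))
          (λ g≐ x → +-cancelˡ-≡ (block a j v x) _ _ (g≐ x)) (IH (s≤s (m∸n≤m l j)) (a + suc j))
      by-length : ∀ {j} → j < suc l →
        HasCard (λ ε → ∃ λ v → v < cyc L j × Split a l j v ε) (cyc L j * D (l ∸ j))
      by-length {j} _ = subst (HasCard _) (∑-const (cyc L j) (D (l ∸ j)))
        (HasCard-⋃ (cyc L j) (λ _ → by-value) split-disjoint-value)
      count : ∑ (suc l) (λ ℓ → cyc L (pred ℓ) * D (l ∸ pred ℓ)) ≡ D (suc l)
      count = trans (∑-cong (suc l) λ { {suc ℓ} _ _ → refl }) (sym (renewal-suc (weight L) l))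

  InS-card : ∀ n → HasCard (InS L n) (renewal (weight L) n)
  InS-card zero = HasCard-𝟘
  InS-card (suc n) =
    HasCard-resp chain→blocks (λ { (m , bs) → blockList→chain m bs }) (S-from-card (suc n) 1)

proposition4p8 : (N : ℕ) → 2 ≤ N → (L : Vec ℕ N) → e L 1 ≢ 0 →
    Σ (ℕ → ℕ) λ C →
      (∀ n → HasCard (InS L n) (C n)) ×
      (∀ k → 1 ≤ k → k ≤ N → C k ≡ ∑ k (λ j → e L j * C (k ∸ j))) ×
      (∀ n → suc N ≤ n →
        C n ≡ ∑ (N ∸ 1) (λ k → e L k * C (n ∸ k)) + (1 + e L N) * C (n ∸ N))
proposition4p8 (suc m) _ L e₁≢0 = C , Blocks.InS-card L e₁≢0 , initial , periodic
  where
  C : ℕ → ℕ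
  C = renewal (weight L)
  initial : ∀ k → 1 ≤ k → k ≤ suc m → C k ≡ ∑ k (λ j → e L j * C (k ∸ j))
  initial (suc l) _ k≤N = trans (renewal-suc (weight L) l)
    (∑-cong (suc l) λ {ℓ} 1≤ℓ ℓ≤k → cong (_* C (suc l ∸ ℓ)) (weight≡e L 1≤ℓ (≤-trans ℓ≤k k≤N)))
  periodic : ∀ n → suc (suc m) ≤ n →
    C n ≡ ∑ m (λ k → e L k * C (n ∸ k)) + (1 + e L (suc m)) * C (n ∸ suc m)
  periodic n N<n = begin
    C n
      ≡⟨ renewal-periodic (weight L) (suc m) (weight-periodic L) N<n ⟩
    ∑ m (λ ℓ → weight L ℓ * C (n ∸ ℓ)) + weight L (suc m) * d + d
      ≡⟨ cong₂ (λ X w → X + w * d + d) low (weight≡e L (s≤s z≤n) ≤-refl) ⟩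
    X + e L (suc m) * d + d                             ≡⟨ +-assoc X _ d ⟩
    X + (e L (suc m) * d + d)                           ≡⟨ cong (X +_) (+-comm (e L (suc m) * d) d) ⟩
    X + (1 + e L (suc m)) * d                           ∎
    where
    open ≡-Reasoning
    d X : ℕ
    d = C (n ∸ suc m)
    X = ∑ m (λ k → e L k * C (n ∸ k))
    low : ∑ m (λ ℓ → weight L ℓ * C (n ∸ ℓ)) ≡ X
    low = ∑-cong m λ {ℓ} 1≤ℓ ℓ≤m → cong (_* C (n ∸ ℓ)) (weight≡e L 1≤ℓ (m≤n⇒m≤1+n ℓ≤m))
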